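{- Let $G$ be a finitely generated abelian group and $H$ a finite abelian group. Suppose there exist $M\ge1$, integers $J_i\ge1$ for $i=1,\dots,M$, shifts $h_{i,j}\in G$ and sets $E_{i,j}\subset H$ for $1\le i\le M$, $1\le j\le J_i$, such that the system of functional equations $$\biguplus_{j=1}^{J_i}\big(\alpha(x+h_{i,j})+E_{i,j}\big)=H\quad\text{for all } i=1,\dots,M \text{ and all } x\in G,$$ in the unknown function $\alpha\colon G\to H$, is aperiodic. Then there exist $M'\ge1$ and finite non-empty sets $F_1,\dots,F_{M'}\subset G\times H$ such that the system of tiling equations $A\oplus F_m=G\times H$, $m=1,\dots,M'$, is aperiodic.
   Context: The notation $\biguplus_{j} S_j = H$ means that the sets $S_j$ are pairwise disjoint and their union is $H$. A function $\alpha\colon G\to H$ is periodic if there is a finite-index subgroup $\Lambda\le G$ with $\alpha(x+h)=\alpha(x)$ for all $x\in G$, $h\in\Lambda$. A system of functional equations is aperiodic if it has at least one solution $\alpha$ but no periodic solution. For an abelian group $K$ and $A,F\subset K$, $A\oplus F=K$ means the translates $a+F$, $a\in A$, are pairwise disjoint with union $K$; $A$ is periodic if it is a finite union of cosets of a finite-index subgroup of $K$; a system of tiling equations $A\oplus F_m=K$ (common unknown $A$) is aperiodic if it has a solution but no periodic solution. -}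

module Defs where

open import Level using (0ℓ)
open import Algebra.Bundles using (AbelianGroup)
open import Algebra.Construct.DirectProduct using (abelianGroup)
open import Data.Nat using (ℕ; _≤_)
open import Data.Fin using (Fin)
open import Data.List using (List; [])
open import Data.List.Relation.Unary.Any using (Any)
open import Data.Product using (Σ; ∃; _×_; _,_)
open import Relation.Unary using (Pred)
open import Relation.Nullary using (¬_)
open import Relation.Binary.PropositionalEquality using (_≡_; _≢_)
open import Function.Bundles using (_⇔_)

Grp : Set₁
Grp = AbelianGroup 0ℓ 0ℓ

_⊗_ : Grp → Grp → Grp
G ⊗ H = abelianGroup G H

module _ (K : Grp) where
  open AbelianGroup K

  RespectsEq : Pred Carrier 0ℓ → Set
  RespectsEq P = ∀ {x y} → x ≈ y → P x → P y

  _∈L_ : Carrier → List Carrier → Set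
  x ∈L xs = Any (λ y → x ≈ y) xs

  data InSpan (gens : List Carrier) : Carrier → Set where
    span-ε   : InSpan gens ε
    span-gen : ∀ {g x} → g ∈L gens → InSpan gens x → InSpan gens (g ∙ x)
    span-inv : ∀ {g x} → g ∈L gens → InSpan gens x → InSpan gens ((g ⁻¹) ∙ x)
    span-≈   : ∀ {x y} → x ≈ y → InSpan gens x → InSpan gens y

  FinitelyGenerated : Set
  FinitelyGenerated = Σ (List Carrier) λ gens → ∀ x → InSpan gens x

  IsFinite : Set
  IsFinite = Σ (List Carrier) λ xs → ∀ x → x ∈L xs

  record IsSubgroup (Λ : Pred Carrier 0ℓ) : Set where
    field
      resp  : RespectsEq Λ
      has-ε : Λ ε
      ∙-cl  : ∀ {x y} → Λ x → Λ y → Λ (x ∙ y)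
      ⁻¹-cl : ∀ {x} → Λ x → Λ (x ⁻¹)

  FiniteIndex : Pred Carrier 0ℓ → Set
  FiniteIndex Λ = Σ (List Carrier) λ reps → ∀ x → Any (λ r → Λ (x ∙ (r ⁻¹))) reps

  IsFiniteIndexSubgroup : Pred Carrier 0ℓ → Set
  IsFiniteIndexSubgroup Λ = IsSubgroup Λ × FiniteIndex Λ

  PeriodicSet : Pred Carrier 0ℓ → Set₁
  PeriodicSet A = Σ (Pred Carrier 0ℓ) λ Λ → IsFiniteIndexSubgroup Λ ×
    Σ (List Carrier) λ reps → ∀ x → A x ⇔ Any (λ r → Λ (x ∙ (r ⁻¹))) reps

  TilesBy : Pred Carrier 0ℓ → List Carrier → Set
  TilesBy A F =
    (∀ x → Σ Carrier λ a → Σ Carrier λ f → A a × f ∈L F × x ≈ a ∙ f) ×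
    (∀ {a a' f f'} → A a → A a' → f ∈L F → f' ∈L F → a ∙ f ≈ a' ∙ f' → a ≈ a')

  TilingSolution : {M : ℕ} → (Fin M → List Carrier) → Pred Carrier 0ℓ → Set
  TilingSolution F A = RespectsEq A × (∀ m → TilesBy A (F m))

  AperiodicTiling : {M : ℕ} → (Fin M → List Carrier) → Set₁
  AperiodicTiling F = (Σ (Pred Carrier 0ℓ) λ A → TilingSolution F A) ×
    ¬ (Σ (Pred Carrier 0ℓ) λ A → TilingSolution F A × PeriodicSet A)

module _ (G H : Grp) where
  private
    module G = AbelianGroup G
    module H = AbelianGroup H

  DisjointUnionIsH : {J : ℕ} → (Fin J → Pred H.Carrier 0ℓ) → Set
  DisjointUnionIsH S = (∀ y → ∃ λ j → S j y) × (∀ {j j' y} → S j y → S j' y → j ≡ j')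

  -- α is a solution of the system: for all i, x,
  --   ⨄_j (α(x + h i j) + E i j) = H
  -- where y ∈ a + E  means  y - a ∈ E.
  FESolution : (M : ℕ) (J : Fin M → ℕ) (h : (i : Fin M) → Fin (J i) → G.Carrier)
    (E : (i : Fin M) → Fin (J i) → Pred H.Carrier 0ℓ) → (G.Carrier → H.Carrier) → Set
  FESolution M J h E α =
    (∀ {x y} → x G.≈ y → α x H.≈ α y) ×
    (∀ i x → DisjointUnionIsH (λ j y → E i j (y H.∙ (α (x G.∙ h i j) H.⁻¹))))

  PeriodicFun : (G.Carrier → H.Carrier) → Set₁
  PeriodicFun α = Σ (Pred G.Carrier 0ℓ) λ Λ → IsFiniteIndexSubgroup G Λ ×
    (∀ x g → Λ g → α (x G.∙ g) H.≈ α x)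

  AperiodicFE : (M : ℕ) (J : Fin M → ℕ) (h : (i : Fin M) → Fin (J i) → G.Carrier)
    (E : (i : Fin M) → Fin (J i) → Pred H.Carrier 0ℓ) → Set₁
  AperiodicFE M J h E = (Σ (G.Carrier → H.Carrier) λ α → FESolution M J h E α) ×
    ¬ (Σ (G.Carrier → H.Carrier) λ α → FESolution M J h E α × PeriodicFun α)

-- A solution α of the functional equations is encoded by its graph A = {(x , α x)} ⊆ G × H.
-- The tile {0} × H forces any tiling set to be the graph of a function, and for a graph the
-- tile ⋃ⱼ {-hᵢⱼ} × Eᵢⱼ tiles exactly when α satisfies the i-th equation. A periodic graph
-- with period lattice Λ ⊆ G × H makes α periodic along {g | (g , 0) ∈ Λ}; this subgroup has
-- finite index because every element of G has a positive multiple in it (pigeonhole on the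
-- finitely many cosets of Λ) and G is finitely generated.
{-# OPTIONS --safe #-}
module Submission where

open import Defs
open import Level using (0ℓ)
open import Algebra.Bundles using (AbelianGroup)
open import Data.Nat using (ℕ; zero; suc; _+_; _≤_; _<_; s≤s; z≤n)
open import Data.Nat.Properties using (n<1+n; m<1+n⇒m<n∨m≡n; m≤n⇒∃[o]m+o≡n)
open import Data.Fin using (Fin; zero; suc; toℕ)
open import Data.Fin.Properties using (pigeonhole)
open import Data.List using (List; []; _∷_; map; upTo; cartesianProductWith; length; lookup)
open import Data.List.Relation.Unary.Any as Any using (Any; here; there)
open import Data.List.Relation.Unary.Any.Properties using (lookup-index; map⁺; map⁻)
open import Data.List.Membership.Propositional using (_∈_; find; lose)
open import Data.List.Membership.Propositional.Properties
  using (∈-upTo⁺; ∈-upTo⁻; ∈-cartesianProductWith⁺; ∈-cartesianProductWith⁻)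
open import Data.Product using (Σ; ∃; _×_; _,_; proj₁; proj₂)
open import Data.Sum using (inj₁; inj₂)
open import Relation.Unary using (Pred)
open import Relation.Binary.PropositionalEquality as ≡ using (_≡_; _≢_)
open import Function.Bundles using (_⇔_; Equivalence)
import Algebra.Properties.Group

map-nonempty : ∀ {A B : Set} {P : A → Set} {xs : List A} (f : A → B) → Any P xs → map f xs ≢ []
map-nonempty f (here _) ()
map-nonempty f (there _) ()

module Solving (K : Grp) where
  open AbelianGroup K
  open import Algebra.Properties.AbelianGroup K using (xyx⁻¹≈y)

  ∙-//-cancel : ∀ a y → a ∙ (y ∙ a ⁻¹) ≈ y
  ∙-//-cancel a y = trans (sym (assoc a y (a ⁻¹))) (xyx⁻¹≈y a y)

  ∙-solveʳ : ∀ {p a b e} → p ≈ a ∙ e → a ≈ b → e ≈ p ∙ b ⁻¹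
  ∙-solveʳ {p} {a} {b} {e} p≈a∙e a≈b = trans (sym (xyx⁻¹≈y a e)) (∙-cong (sym p≈a∙e) (⁻¹-cong a≈b))

module Cosets (K : Grp) {Λ : Pred (AbelianGroup.Carrier K) 0ℓ} (Λ-sub : IsSubgroup K Λ) where
  open AbelianGroup K
  open import Algebra.Properties.AbelianGroup K
  open import Algebra.Properties.Monoid monoid using (cancelᶜ)
  open import Algebra.Properties.CommutativeSemigroup commutativeSemigroup using (interchange)
  open IsSubgroup Λ-sub

  infix 4 _∼_
  _∼_ : Carrier → Carrier → Set
  x ∼ y = Λ (x ∙ y ⁻¹)

  ∼-reflexive : ∀ {x y} → x ≈ y → x ∼ y
  ∼-reflexive x≈y = resp (sym (x≈y⇒x∙y⁻¹≈ε x≈y)) has-ε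

  ∼-sym : ∀ {x y} → x ∼ y → y ∼ x
  ∼-sym {x} {y} x∼y = resp (⁻¹-anti-homo-// x y) (⁻¹-cl x∼y)

  ∼-trans : ∀ {x y z} → x ∼ y → y ∼ z → x ∼ z
  ∼-trans {x} {y} {z} x∼y y∼z = resp (cancelᶜ (inverseˡ y) x (z ⁻¹)) (∙-cl x∼y y∼z)

  ∼-∙-cong : ∀ {x y u v} → x ∼ y → u ∼ v → x ∙ u ∼ y ∙ v
  ∼-∙-cong {x} {y} {u} {v} x∼y u∼v =
    resp (trans (interchange x (y ⁻¹) u (v ⁻¹)) (∙-congˡ (⁻¹-∙-comm y v))) (∙-cl x∼y u∼v)

  ∈Λ⇒∼ε : ∀ {l} → Λ l → l ∼ ε
  ∈Λ⇒∼ε {l} l∈Λ = resp (sym (trans (∙-congˡ ε⁻¹≈ε) (identityʳ l))) l∈Λ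

  ∼-absorbʳ : ∀ {x l} → Λ l → x ∙ l ∼ x
  ∼-absorbʳ {x} l∈Λ = ∼-trans (∼-∙-cong (∼-reflexive refl) (∈Λ⇒∼ε l∈Λ)) (∼-reflexive (identityʳ x))

  cosetUnion-absorbʳ : ∀ (A : Pred Carrier 0ℓ) reps → (∀ x → A x ⇔ Any (x ∼_) reps) →
    ∀ {x l} → Λ l → A x → A (x ∙ l)
  cosetUnion-absorbʳ A reps A⇔ l∈Λ x∈A = Equivalence.from (A⇔ _)
    (Any.map (∼-trans (∼-absorbʳ l∈Λ)) (Equivalence.to (A⇔ _) x∈A))

module Multiples (K : Grp) where
  open AbelianGroup K
  open import Algebra.Properties.AbelianGroup K
  open import Algebra.Properties.CommutativeSemigroup commutativeSemigroup using (x∙yz≈y∙xz)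
  open import Algebra.Properties.Monoid.Mult monoid public using (×-homo-+; ×-congˡ) renaming (_×_ to _·_)

  TorsionModulo : Pred Carrier 0ℓ → Set
  TorsionModulo Λ = ∀ x → ∃ λ n → Λ (suc n · x)

  multiple-difference : ∀ m n x → (suc m + n) · x ∙ (m · x) ⁻¹ ≈ suc n · x
  multiple-difference m n x = trans
    (∙-congʳ (trans (∙-congˡ (×-homo-+ x m n)) (x∙yz≈y∙xz x (m · x) (n · x))))
    (xyx⁻¹≈y (m · x) (suc n · x))

  ∙-raise-multiple : ∀ {g γ} r c → g ≈ γ → g ∙ (r ∙ c · γ) ≈ r ∙ suc c · γ
  ∙-raise-multiple {g} {γ} r c g≈γ = trans (∙-congʳ g≈γ) (x∙yz≈y∙xz γ r (c · γ))

  module _ {Λ : Pred Carrier 0ℓ} (Λ-sub : IsSubgroup K Λ) where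
    open IsSubgroup Λ-sub
    open Cosets K Λ-sub

    finiteIndex⇒torsion : FiniteIndex K Λ → TorsionModulo Λ
    finiteIndex⇒torsion (reps , covered) x =
      let i , j , i<j , sameCoset = pigeonhole (n<1+n (length reps)) cosetOf
          δ , i+1+δ≡j = m≤n⇒∃[o]m+o≡n i<j
      in δ , resp (trans (∙-congʳ (×-congˡ (≡.sym i+1+δ≡j))) (multiple-difference (toℕ i) δ x))
                  (∼-trans (inCoset j) (∼-sym (≡.subst (λ c → toℕ i · x ∼ lookup reps c) sameCoset (inCoset i))))
      where
      cosetOf : Fin (suc (length reps)) → Fin (length reps)
      cosetOf c = Any.index (covered (toℕ c · x))
      inCoset : ∀ c → toℕ c · x ∼ lookup reps (cosetOf c)
      inCoset c = lookup-index (covered (toℕ c · x))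

    module _ (torsion : TorsionModulo Λ) where
      Covered : List Carrier → Carrier → Set
      Covered reps x = Any (x ∼_) reps

      period : Carrier → ℕ
      period x = suc (proj₁ (torsion x))

      -- The sums Σₖ cₖ γₖ with 0 ≤ cₖ < period γₖ; they meet every coset of Λ in ⟨γs⟩.
      box : List Carrier → List Carrier
      box [] = ε ∷ []
      box (γ ∷ γs) = cartesianProductWith (λ r c → r ∙ c · γ) (box γs) (upTo (period γ))

      Covered-∼ : ∀ {reps x y} → x ∼ y → Covered reps y → Covered reps x
      Covered-∼ x∼y = Any.map (∼-trans x∼y)

      box-extend : ∀ {γ} γs {r c} → r ∈ box γs → c < period γ → r ∙ c · γ ∈ box (γ ∷ γs)
      box-extend γs r∈ c< = ∈-cartesianProductWith⁺ _ r∈ (∈-upTo⁺ c<)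

      box-closed-head : ∀ {γ} γs {g r c} → r ∈ box γs → c < period γ → g ≈ γ →
        Covered (box (γ ∷ γs)) (g ∙ (r ∙ c · γ))
      box-closed-head {γ} γs {g} {r} {c} r∈ c< g≈γ with m<1+n⇒m<n∨m≡n c<
      ... | inj₁ c+1< = lose (box-extend γs r∈ (s≤s c+1<)) (∼-reflexive (∙-raise-multiple r c g≈γ))
      ... | inj₂ ≡.refl = lose (box-extend γs {c = 0} r∈ (s≤s z≤n))
              (∼-trans (∼-reflexive (∙-raise-multiple r c g≈γ)) (∼-∙-cong (∼-reflexive refl) (∈Λ⇒∼ε (proj₂ (torsion γ)))))

      box-closed : ∀ γs {g r} → _∈L_ K g γs → r ∈ box γs → Covered (box γs) (g ∙ r)
      box-closed (γ ∷ γs) g∈ r∈ with ∈-cartesianProductWith⁻ (λ r c → r ∙ c · γ) (box γs) (upTo (period γ)) r∈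
      box-closed (γ ∷ γs) (here g≈γ) _ | r₀ , c , r₀∈ , c∈ , ≡.refl =
        box-closed-head γs r₀∈ (∈-upTo⁻ c∈) g≈γ
      box-closed (γ ∷ γs) {g} (there g∈γs) _ | r₀ , c , r₀∈ , c∈ , ≡.refl =
        let r₁ , r₁∈ , g∙r₀∼r₁ = find (box-closed γs g∈γs r₀∈)
        in lose (box-extend γs r₁∈ (∈-upTo⁻ c∈))
                (∼-trans (∼-reflexive (sym (assoc g r₀ (c · γ)))) (∼-∙-cong g∙r₀∼r₁ (∼-reflexive refl)))

      Covered-generator : ∀ γs {g x} → _∈L_ K g γs → Covered (box γs) x → Covered (box γs) (g ∙ x)
      Covered-generator γs g∈ x-covered =
        let r , r∈ , x∼r = find x-covered
        in Covered-∼ (∼-∙-cong (∼-reflexive refl) x∼r) (box-closed γs g∈ r∈)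

      Covered-multiple : ∀ γs {g x} → _∈L_ K g γs → ∀ n → Covered (box γs) x → Covered (box γs) (n · g ∙ x)
      Covered-multiple γs {x = x} g∈ zero x-covered = Covered-∼ (∼-reflexive (identityˡ x)) x-covered
      Covered-multiple γs {g} {x} g∈ (suc n) x-covered =
        Covered-∼ (∼-reflexive (assoc g (n · g) x)) (Covered-generator γs g∈ (Covered-multiple γs g∈ n x-covered))

      Covered-inverse : ∀ γs {g x} → _∈L_ K g γs → Covered (box γs) x → Covered (box γs) (g ⁻¹ ∙ x)
      Covered-inverse γs {g} g∈ x-covered =
        Covered-∼ (∼-∙-cong g⁻¹∼n·g (∼-reflexive refl)) (Covered-multiple γs g∈ n x-covered)
        where
        n : ℕ
        n = proj₁ (torsion g)
        g⁻¹∼n·g : g ⁻¹ ∼ n · g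
        g⁻¹∼n·g = resp (sym (⁻¹-∙-comm g (n · g))) (⁻¹-cl (proj₂ (torsion g)))

      box-ε : ∀ γs → Covered (box γs) ε
      box-ε [] = here (∼-reflexive refl)
      box-ε (γ ∷ γs) =
        let r , r∈ , ε∼r = find (box-ε γs)
        in lose (box-extend γs {c = 0} r∈ (s≤s z≤n)) (∼-trans ε∼r (∼-reflexive (sym (identityʳ r))))

      span⇒Covered : ∀ {γs x} → InSpan K γs x → Covered (box γs) x
      span⇒Covered {γs} span-ε = box-ε γs
      span⇒Covered {γs} (span-gen g∈ x∈) = Covered-generator γs g∈ (span⇒Covered x∈)
      span⇒Covered {γs} (span-inv g∈ x∈) = Covered-inverse γs g∈ (span⇒Covered x∈)
      span⇒Covered (span-≈ x≈y x∈) = Covered-∼ (∼-reflexive (sym x≈y)) (span⇒Covered x∈)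

      torsion⇒finiteIndex : FinitelyGenerated K → FiniteIndex K Λ
      torsion⇒finiteIndex (γs , spans) = box γs , λ x → span⇒Covered (spans x)

module Slice (G H : Grp) where
  private
    module G = AbelianGroup G
    module H = AbelianGroup H
    module K = AbelianGroup (G ⊗ H)
    module MG = Multiples G
    module MK = Multiples (G ⊗ H)
  open import Algebra.Properties.Group H.group using (ε⁻¹≈ε)

  slice : Pred K.Carrier 0ℓ → Pred G.Carrier 0ℓ
  slice Λ g = Λ (g , H.ε)

  module _ {Λ : Pred K.Carrier 0ℓ} (Λ-sub : IsSubgroup (G ⊗ H) Λ) where
    open IsSubgroup Λ-sub

    slice-isSubgroup : IsSubgroup G (slice Λ)
    slice-isSubgroup = record
      { resp  = λ x≈y → resp (x≈y , H.refl)
      ; has-ε = has-ε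
      ; ∙-cl  = λ x∈ y∈ → resp (G.refl , H.identityʳ H.ε) (∙-cl x∈ y∈)
      ; ⁻¹-cl = λ x∈ → resp (G.refl , ε⁻¹≈ε) (⁻¹-cl x∈)
      }

    multiple-inclusion : ∀ n g → n MK.· (g , H.ε) K.≈ (n MG.· g , H.ε)
    multiple-inclusion zero g = K.refl
    multiple-inclusion (suc n) g = K.trans (K.∙-congˡ (multiple-inclusion n g)) (G.refl , H.identityʳ H.ε)

    slice-finiteIndex : FinitelyGenerated G → FiniteIndex (G ⊗ H) Λ → IsFiniteIndexSubgroup G (slice Λ)
    slice-finiteIndex G-fg Λ-index =
      slice-isSubgroup , MG.torsion⇒finiteIndex slice-isSubgroup slice-torsion G-fg
      where
      slice-torsion : MG.TorsionModulo (slice Λ)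
      slice-torsion g =
        let n , n·g∈Λ = MK.finiteIndex⇒torsion Λ-sub Λ-index (g , H.ε)
        in n , resp (multiple-inclusion (suc n) g) n·g∈Λ

module Graphs (G H : Grp) where
  private
    module G = AbelianGroup G
    module H = AbelianGroup H
    module K = AbelianGroup (G ⊗ H)
  open Slice G H
  open Solving H

  Congruent : (G.Carrier → H.Carrier) → Set
  Congruent α = ∀ {x y} → x G.≈ y → α x H.≈ α y

  graph : (G.Carrier → H.Carrier) → Pred K.Carrier 0ℓ
  graph α (x , y) = y H.≈ α x

  IsGraphOf : Pred K.Carrier 0ℓ → (G.Carrier → H.Carrier) → Set
  IsGraphOf A α = (∀ x → A (x , α x)) × (∀ {x y} → A (x , y) → y H.≈ α x)

  graph-isGraphOf : ∀ α → IsGraphOf (graph α) α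
  graph-isGraphOf α = (λ _ → H.refl) , λ y≈αx → y≈αx

  graph-respects : ∀ {α} → Congruent α → RespectsEq (G ⊗ H) (graph α)
  graph-respects α-cong (x≈x′ , y≈y′) y≈αx = H.trans (H.sym y≈y′) (H.trans y≈αx (α-cong x≈x′))

  isGraphOf-congruent : ∀ {A α} → RespectsEq (G ⊗ H) A → IsGraphOf A α → Congruent α
  isGraphOf-congruent A-resp (onGraph , unique) x≈x′ = unique (A-resp (x≈x′ , H.refl) (onGraph _))

  isGraphOf-determined : ∀ {A α a a′} → IsGraphOf A α → Congruent α → A a → A a′ →
    proj₁ a G.≈ proj₁ a′ → a K.≈ a′
  isGraphOf-determined (_ , unique) α-cong a∈ a′∈ a₁≈a₁′ =
    a₁≈a₁′ , H.trans (unique a∈) (H.trans (α-cong a₁≈a₁′) (H.sym (unique a′∈)))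

  isGraphOf-periodic : ∀ {A α} → FinitelyGenerated G → IsGraphOf A α → PeriodicSet (G ⊗ H) A → PeriodicFun G H α
  isGraphOf-periodic {A} {α} G-fg (onGraph , unique) (Λ , (Λ-sub , Λ-index) , reps , A⇔) =
    slice Λ , slice-finiteIndex Λ-sub G-fg Λ-index , periodic
    where
    open Cosets (G ⊗ H) Λ-sub using (cosetUnion-absorbʳ)
    periodic : ∀ x g → slice Λ g → α (x G.∙ g) H.≈ α x
    periodic x g g∈ = H.trans (H.sym (unique (cosetUnion-absorbʳ A reps A⇔ g∈ (onGraph x)))) (H.identityʳ (α x))

  module Fibre (Hs : List H.Carrier) (Hs-complete : ∀ y → _∈L_ H y Hs) where
    fibre : List K.Carrier
    fibre = map (G.ε ,_) Hs

    ∈-fibre⁺ : ∀ {g y} → g G.≈ G.ε → _∈L_ (G ⊗ H) (g , y) fibre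
    ∈-fibre⁺ {y = y} g≈ε = map⁺ (Any.map (g≈ε ,_) (Hs-complete y))

    ∈-fibre⁻ : ∀ {f} → _∈L_ (G ⊗ H) f fibre → proj₁ f G.≈ G.ε
    ∈-fibre⁻ f∈ = proj₁ (proj₂ (Any.satisfied (map⁻ f∈)))

    ∙-fibre : ∀ {f} a → _∈L_ (G ⊗ H) f fibre → a G.∙ proj₁ f G.≈ a
    ∙-fibre a f∈ = G.trans (G.∙-congˡ (∈-fibre⁻ f∈)) (G.identityʳ a)

    fibre-nonempty : fibre ≢ []
    fibre-nonempty = map-nonempty (G.ε ,_) (Hs-complete H.ε)

    graph-tiles-fibre : ∀ {A α} → IsGraphOf A α → Congruent α → TilesBy (G ⊗ H) A fibre
    graph-tiles-fibre {A} {α} (onGraph , unique) α-cong = covers , disjoint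
      where
      covers : ∀ p → Σ K.Carrier λ a → Σ K.Carrier λ f → A a × _∈L_ (G ⊗ H) f fibre × p K.≈ a K.∙ f
      covers (x , y) = (x , α x) , (G.ε , y H.∙ α x H.⁻¹) , onGraph x , ∈-fibre⁺ G.refl ,
        G.sym (G.identityʳ x) , H.sym (∙-//-cancel (α x) y)
      disjoint : ∀ {a a′ f f′} → A a → A a′ → _∈L_ (G ⊗ H) f fibre → _∈L_ (G ⊗ H) f′ fibre →
        a K.∙ f K.≈ a′ K.∙ f′ → a K.≈ a′
      disjoint {a₁ , a₂} {a₁′ , a₂′} a∈ a′∈ f∈ f′∈ (a∙f≈a′∙f′ , _) =
        isGraphOf-determined (onGraph , unique) α-cong a∈ a′∈ a₁≈a₁′
        where
        a₁≈a₁′ : a₁ G.≈ a₁′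
        a₁≈a₁′ = G.trans (G.sym (∙-fibre a₁ f∈)) (G.trans a∙f≈a′∙f′ (∙-fibre a₁′ f′∈))

    fibreTiling⇒graph : ∀ {A} → RespectsEq (G ⊗ H) A → TilesBy (G ⊗ H) A fibre →
      Σ (G.Carrier → H.Carrier) (IsGraphOf A)
    fibreTiling⇒graph {A} A-resp (covers , disjoint) = α , onGraph , unique
      where
      α : G.Carrier → H.Carrier
      α x = proj₂ (proj₁ (covers (x , H.ε)))
      onGraph : ∀ x → A (x , α x)
      onGraph x with covers (x , H.ε)
      ... | (a₁ , a₂) , f , a∈ , f∈ , (x≈a₁∙f₁ , _) =
        A-resp (G.sym (G.trans x≈a₁∙f₁ (∙-fibre a₁ f∈)) , H.refl) a∈
      unique : ∀ {x y} → A (x , y) → y H.≈ α x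
      unique {x} {y} xy∈ with covers (x , H.ε)
      ... | a , f , a∈ , f∈ , x,ε≈a∙f =
        proj₂ (disjoint xy∈ a∈ (∈-fibre⁺ G.refl) f∈ (K.trans (G.identityʳ x , H.inverseʳ y) x,ε≈a∙f))

module EquationTiles (G H : Grp) (Hs : List (AbelianGroup.Carrier H))
  (Hs-complete : ∀ y → _∈L_ H y Hs) {M : ℕ} {J : Fin M → ℕ}
  (h : (i : Fin M) → Fin (J i) → AbelianGroup.Carrier G)
  (E : (i : Fin M) → Fin (J i) → Pred (AbelianGroup.Carrier H) 0ℓ)
  (E-resp : ∀ i j → RespectsEq H (E i j))
  (α₀ : AbelianGroup.Carrier G → AbelianGroup.Carrier H) (α₀-solution : FESolution G H M J h E α₀) where
  private
    module G = AbelianGroup G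
    module H = AbelianGroup H
    module K = AbelianGroup (G ⊗ H)
    module GP = Algebra.Properties.Group G.group
    module HP = Algebra.Properties.Group H.group
  open Solving H
  open Graphs G H
  open Fibre Hs Hs-complete

  Equation : Fin M → (G.Carrier → H.Carrier) → Set
  Equation i α = ∀ x → DisjointUnionIsH G H (λ j y → E i j (y H.∙ α (x G.∙ h i j) H.⁻¹))

  coveringIndex : ∀ i → H.Carrier → Fin (J i)
  coveringIndex i y = proj₁ (proj₁ (proj₂ α₀-solution i G.ε) y)

  point : ∀ i → Fin (J i) → H.Carrier → K.Carrier
  point i j y = h i j G.⁻¹ , y H.∙ α₀ (G.ε G.∙ h i j) H.⁻¹

  -- ⋃ⱼ {-hᵢⱼ} × Eᵢⱼ, listed through α₀: each y ∈ H lies in α₀(hᵢⱼ) + Eᵢⱼ for exactly one j.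
  tile : Fin M → List K.Carrier
  tile i = map (λ y → point i (coveringIndex i y) y) Hs

  tile-nonempty : ∀ i → tile i ≢ []
  tile-nonempty i = map-nonempty _ (Hs-complete H.ε)

  index-unique : ∀ {i j j′ e} → E i j e → E i j′ e → h i j G.≈ h i j′ → j ≡ j′
  index-unique {i} {j} {j′} {e} e∈ e∈′ hᵢⱼ≈hᵢⱼ′ =
    proj₂ (proj₂ α₀-solution i G.ε)
      (E-resp i j (H.sym (HP.//-rightDividesʳ w e)) e∈)
      (E-resp i j′ (H.sym (H.trans (H.∙-congˡ (H.⁻¹-cong (α₀-cong (G.∙-congˡ (G.sym hᵢⱼ≈hᵢⱼ′))))) (HP.//-rightDividesʳ w e))) e∈′)
    where
    w : H.Carrier
    w = α₀ (G.ε G.∙ h i j)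
    α₀-cong : Congruent α₀
    α₀-cong = proj₁ α₀-solution

  coveringIndex-covers : ∀ i y → E i (coveringIndex i y) (y H.∙ α₀ (G.ε G.∙ h i (coveringIndex i y)) H.⁻¹)
  coveringIndex-covers i y = proj₂ (proj₁ (proj₂ α₀-solution i G.ε) y)

  ∈-tile⁻ : ∀ {i f} → _∈L_ (G ⊗ H) f (tile i) →
    Σ (Fin (J i)) λ j → Σ H.Carrier λ e → E i j e × f K.≈ (h i j G.⁻¹ , e)
  ∈-tile⁻ {i} f∈ =
    let y , f≈ = Any.satisfied (map⁻ f∈)
    in coveringIndex i y , _ , coveringIndex-covers i y , f≈

  coveringIndex-unique : ∀ {i j y} → E i j (y H.∙ α₀ (G.ε G.∙ h i j) H.⁻¹) → coveringIndex i y ≡ j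
  coveringIndex-unique {i} {j} {y} y∈ = proj₂ (proj₂ α₀-solution i G.ε) (coveringIndex-covers i y) y∈

  ∈-tile⁺ : ∀ {i j e} → E i j e → _∈L_ (G ⊗ H) (h i j G.⁻¹ , e) (tile i)
  ∈-tile⁺ {i} {j} {e} e∈ = map⁺ (Any.map (λ w∙e≈y → matches (∙-solveʳ (H.sym w∙e≈y) H.refl)) (Hs-complete (w H.∙ e)))
    where
    w : H.Carrier
    w = α₀ (G.ε G.∙ h i j)
    matches : ∀ {y} → e H.≈ y H.∙ w H.⁻¹ → (h i j G.⁻¹ , e) K.≈ point i (coveringIndex i y) y
    matches {y} e≈ with coveringIndex i y | coveringIndex-unique (E-resp i j e≈ e∈)
    ... | _ | ≡.refl = G.refl , e≈

  tile-landing : ∀ {A α i a f p} → IsGraphOf A α → Congruent α → A a → _∈L_ (G ⊗ H) f (tile i) →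
    p K.≈ a K.∙ f →
    Σ (Fin (J i)) λ j → proj₁ a G.≈ proj₁ p G.∙ h i j × E i j (proj₂ p H.∙ α (proj₁ p G.∙ h i j) H.⁻¹)
  tile-landing {i = i} {a = a₁ , a₂} {p = p₁ , p₂} (_ , unique) α-cong a∈ f∈ (p₁≈ , p₂≈) with ∈-tile⁻ f∈
  ... | j , e , e∈ , (f₁≈ , f₂≈) =
    j , a₁≈ , E-resp i j (∙-solveʳ (H.trans p₂≈ (H.∙-congˡ f₂≈)) (H.trans (unique a∈) (α-cong a₁≈))) e∈
    where
    a₁≈ : a₁ G.≈ p₁ G.∙ h i j
    a₁≈ = G.sym (G.trans (G.∙-congʳ (G.trans p₁≈ (G.∙-congˡ f₁≈))) (GP.//-rightDividesˡ (h i j) a₁))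

  equation⇒tiles : ∀ {A α} i → IsGraphOf A α → Congruent α → Equation i α → TilesBy (G ⊗ H) A (tile i)
  equation⇒tiles {A} {α} i isGraph α-cong equation = covers , disjoint
    where
    covers : ∀ p → Σ K.Carrier λ a → Σ K.Carrier λ f → A a × _∈L_ (G ⊗ H) f (tile i) × p K.≈ a K.∙ f
    covers (x , y) =
      let j , y∈ = proj₁ (equation x) y
      in (x G.∙ h i j , α (x G.∙ h i j)) , (h i j G.⁻¹ , y H.∙ α (x G.∙ h i j) H.⁻¹) ,
         proj₁ isGraph _ , ∈-tile⁺ y∈ , G.sym (GP.//-rightDividesʳ (h i j) x) , H.sym (∙-//-cancel _ y)
    disjoint : ∀ {a a′ f f′} → A a → A a′ → _∈L_ (G ⊗ H) f (tile i) → _∈L_ (G ⊗ H) f′ (tile i) →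
      a K.∙ f K.≈ a′ K.∙ f′ → a K.≈ a′
    disjoint {a₁ , a₂} {a₁′ , a₂′} {f₁ , f₂} a∈ a′∈ f∈ f′∈ a∙f≈a′∙f′
      with tile-landing isGraph α-cong a∈ f∈ K.refl | tile-landing isGraph α-cong a′∈ f′∈ a∙f≈a′∙f′
    ... | j , a₁≈ , y∈ | j′ , a₁′≈ , y∈′ with proj₂ (equation (a₁ G.∙ f₁)) y∈ y∈′
    ... | ≡.refl = isGraphOf-determined isGraph α-cong a∈ a′∈ (G.trans a₁≈ (G.sym a₁′≈))

  tiles⇒equation : ∀ {A α} i → IsGraphOf A α → Congruent α → TilesBy (G ⊗ H) A (tile i) → Equation i α
  tiles⇒equation {A} {α} i isGraph α-cong (covers , disjoint) x = covered , unique
    where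
    covered : ∀ y → ∃ λ j → E i j (y H.∙ α (x G.∙ h i j) H.⁻¹)
    covered y =
      let a , f , a∈ , f∈ , p≈ = covers (x , y)
          j , _ , y∈ = tile-landing isGraph α-cong a∈ f∈ p≈
      in j , y∈
    unique : ∀ {j j′ y} → E i j (y H.∙ α (x G.∙ h i j) H.⁻¹) → E i j′ (y H.∙ α (x G.∙ h i j′) H.⁻¹) → j ≡ j′
    unique {j} {j′} {y} y∈ y∈′ = index-unique y∈ (E-resp i j′ (H.∙-congˡ (H.⁻¹-cong (α-cong (G.sym x∙h≈x∙h′)))) y∈′)
      (GP.∙-cancelˡ x (h i j) (h i j′) x∙h≈x∙h′)
      where
      x∙h≈x∙h′ : x G.∙ h i j G.≈ x G.∙ h i j′
      x∙h≈x∙h′ = proj₁ (disjoint (proj₁ isGraph (x G.∙ h i j)) (proj₁ isGraph (x G.∙ h i j′))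
        (∈-tile⁺ y∈) (∈-tile⁺ y∈′)
        (G.trans (GP.//-rightDividesʳ (h i j) x) (G.sym (GP.//-rightDividesʳ (h i j′) x)) ,
         H.trans (∙-//-cancel _ y) (H.sym (∙-//-cancel _ y))))

  tiles : Fin (suc M) → List K.Carrier
  tiles zero = fibre
  tiles (suc i) = tile i

  tiles-nonempty : ∀ m → tiles m ≢ []
  tiles-nonempty zero = fibre-nonempty
  tiles-nonempty (suc i) = tile-nonempty i

  solution⇒tiling : ∀ {α} → FESolution G H M J h E α → TilingSolution (G ⊗ H) tiles (graph α)
  solution⇒tiling {α} (α-cong , equations) = graph-respects α-cong , λ where
    zero → graph-tiles-fibre (graph-isGraphOf α) α-cong
    (suc i) → equation⇒tiles i (graph-isGraphOf α) α-cong (equations i)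

  tiling⇒solution : ∀ {A} → TilingSolution (G ⊗ H) tiles A →
    Σ (G.Carrier → H.Carrier) λ α → FESolution G H M J h E α × IsGraphOf A α
  tiling⇒solution (A-resp , tilings) =
    let α , isGraph = fibreTiling⇒graph A-resp (tilings zero)
        α-cong = isGraphOf-congruent A-resp isGraph
    in α , (α-cong , λ i → tiles⇒equation i isGraph α-cong (tilings (suc i))) , isGraph

theorem4p1 : (G H : Grp) → FinitelyGenerated G → IsFinite H →
    (M : ℕ) → 1 ≤ M → (J : Fin M → ℕ) → (∀ i → 1 ≤ J i) →
    (h : (i : Fin M) → Fin (J i) → AbelianGroup.Carrier G) →
    (E : (i : Fin M) → Fin (J i) → Pred (AbelianGroup.Carrier H) 0ℓ) →
    (∀ i j → RespectsEq H (E i j)) →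
    AperiodicFE G H M J h E →
    Σ ℕ λ M' → 1 ≤ M' ×
      Σ (Fin M' → List (AbelianGroup.Carrier (G ⊗ H))) λ F →
        (∀ m → F m ≢ []) × AperiodicTiling (G ⊗ H) F
theorem4p1 G H G-fg (Hs , Hs-complete) M _ J _ h E E-resp ((α₀ , α₀-solution) , no-periodic-solution) =
  suc M , s≤s z≤n , tiles , tiles-nonempty , (graph α₀ , solution⇒tiling α₀-solution) ,
  λ (A , A-tiling , A-periodic) →
    let α , α-solution , A-isGraph = tiling⇒solution A-tiling
    in no-periodic-solution (α , α-solution , isGraphOf-periodic G-fg A-isGraph A-periodic)
  where
  open Graphs G H using (graph; isGraphOf-periodic)
  open EquationTiles G H Hs Hs-complete h E E-resp α₀ α₀-solution
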